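{- For all integers $n$ and $i$ with $-1 \leq i \leq n-3$, $$x_{n + i} + x_{n - i - 2} \geq \begin{cases} x_{n - 2} + x_n, & i \text{ even},\\ 2x_{n - 1}, & i \text{ odd}.\end{cases}$$
   Context: The sequence $(x_n)_{n\ge1}$ is defined by $x_1 = 0, x_2 = 1, x_3 = 2, x_4 = 4, x_5 = 5$ and, for $n \geq 6$, $$x_n = (n - 1) + \begin{cases} x_{\frac{n + 1}{2}} + x_{\frac{n - 3}{2}}, & n \equiv 1 \pmod 4,\\ 2 x_{\frac{n - 1}{2}}, & n \equiv 3 \pmod 4,\\ x_{\frac{n}{2}} + x_{\frac{n - 2}{2}}, & n \text{ even}. \end{cases}$$ -}

module Defs where

open import Data.Nat using (ℕ; zero; suc; _+_; _*_; _∸_; _/_; _%_)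

-- Auxiliary with fuel: xAux f n computes x_n correctly whenever f ≥ n
-- (every recursive call has a strictly smaller index, all ≥ 1).
xAux : ℕ → ℕ → ℕ
xAux zero    n = 0
xAux (suc f) 0 = 0   -- x_0 is not part of the sequence (indices start at 1)
xAux (suc f) 1 = 0
xAux (suc f) 2 = 1
xAux (suc f) 3 = 2
xAux (suc f) 4 = 4
xAux (suc f) 5 = 5
xAux (suc f) n@(suc (suc (suc (suc (suc (suc _)))))) with n % 4
... | 1 = (n ∸ 1) + (xAux f ((n + 1) / 2) + xAux f ((n ∸ 3) / 2))
... | 3 = (n ∸ 1) + 2 * xAux f ((n ∸ 1) / 2)
... | _ = (n ∸ 1) + (xAux f (n / 2) + xAux f ((n ∸ 2) / 2))

x : ℕ → ℕ
x n = xAux n n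

-- Write Δk = x(k+1) − x(k).  For k ≥ 6 the recurrence gives Δk = 1 + Δ(g k), where
-- g(4t+6) = 2t+2, g(4t+7) = g(4t+9) = 2t+3 and g(4t+8) = 2t+4.  Hence Δk ≤ Δ(k+2) holds for
-- all k by strong induction (directly for k < 6), i.e. the increments are nondecreasing along
-- each parity class.  Summing L consecutive increments gives
-- x(a+L) − x(a) ≤ x(a+s+L) − x(a+s) for every even s; with a = n − i − 2 this is the
-- inequality for even i (L = i, s = i+2) and for odd i (L = s = i+1).
module Submission where

open import Data.Nat using (ℕ; zero; suc; _+_; _*_; _∸_; _≤_; _<_; _%_; _/_; s≤s)
open import Data.Nat.DivMod using (m*n/n≡m; [m+kn]%n≡m%n; m≡m%n+[m/n]*n)
open import Data.Nat.Induction using (<-rec)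
open import Data.Nat.Properties
open import Algebra.Properties.CommutativeSemigroup +-commutativeSemigroup using (x∙yz≈y∙xz)
open import Data.Nat.Tactic.RingSolver using (solve-∀)
open import Data.Product using (_,_; _×_)
open import Relation.Binary.PropositionalEquality

open import Defs

-- a ⊖ b ≼ c ⊖ d says a − b ≤ c − d, cross-multiplied to avoid truncated subtraction.  It is a
-- record (as is Δ_≡1+Δ_ below) so that its indices can be inferred.
infix 4 _⊖_≼_⊖_

record _⊖_≼_⊖_ (a b c d : ℕ) : Set where
  constructor ≤⇒≼
  field ≼⇒≤ : a + d ≤ c + b

open _⊖_≼_⊖_

≼-refl : ∀ {a b} → a ⊖ b ≼ a ⊖ b
≼-refl = ≤⇒≼ ≤-refl

≼-trans : ∀ {a b c d e f} → a ⊖ b ≼ c ⊖ d → c ⊖ d ≼ e ⊖ f → a ⊖ b ≼ e ⊖ f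
≼-trans {a} {b} {c} {d} {e} {f} (≤⇒≼ p) (≤⇒≼ q) = ≤⇒≼ (+-cancelʳ-≤ (c + d) (a + f) (e + b) (begin
  a + f + (c + d)   ≡⟨ lhs a c d f ⟩
  a + d + (c + f)   ≤⟨ +-mono-≤ p q ⟩
  c + b + (e + d)   ≡⟨ rhs b c d e ⟩
  e + b + (c + d)   ∎))
  where
  open ≤-Reasoning
  lhs : ∀ a c d f → a + f + (c + d) ≡ a + d + (c + f)
  lhs = solve-∀
  rhs : ∀ b c d e → c + b + (e + d) ≡ e + b + (c + d)
  rhs = solve-∀

≼-swap : ∀ {a b c d} → a ⊖ b ≼ c ⊖ d → a ⊖ c ≼ b ⊖ d
≼-swap {a} {b} {c} {d} (≤⇒≼ p) = ≤⇒≼ (subst (a + d ≤_) (+-comm c b) p)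

≼-telescope : ∀ {a b c d e f} → a ⊖ b ≼ c ⊖ d → b ⊖ e ≼ d ⊖ f → a ⊖ e ≼ c ⊖ f
≼-telescope p q = ≼-swap (≼-trans (≼-swap p) (≼-swap q))

module Increments (f : ℕ → ℕ) where

  infix 4 Δ_≼Δ_ Δ_≡1+Δ_

  Δ_≼Δ_ : ℕ → ℕ → Set
  Δ i ≼Δ j = f (suc i) ⊖ f i ≼ f (suc j) ⊖ f j

  record Δ_≡1+Δ_ (k i : ℕ) : Set where
    constructor ≡⇒≡1+Δ
    field ≡1+Δ⇒≡ : f (suc k) + f i ≡ suc (f (suc i) + f k)

  open Δ_≡1+Δ_ public

  ≡1+Δ⇒≼Δ : ∀ {i j k l} → Δ k ≡1+Δ i → Δ l ≡1+Δ j → Δ i ≼Δ j → Δ k ≼Δ l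
  ≡1+Δ⇒≼Δ (≡⇒≡1+Δ Δk≡1+Δi) (≡⇒≡1+Δ Δl≡1+Δj) (≤⇒≼ Δi≼Δj) =
    ≼-trans (≤⇒≼ (≤-reflexive Δk≡1+Δi))
      (≼-trans (≤⇒≼ (s≤s Δi≼Δj)) (≤⇒≼ (≤-reflexive (sym Δl≡1+Δj))))

  module _ (d : ℕ) (Δ-mono : ∀ k → Δ k ≼Δ (d + k)) where

    Δ-mono-multiple : ∀ q k → Δ k ≼Δ (q * d + k)
    Δ-mono-multiple zero    k = ≼-refl
    Δ-mono-multiple (suc q) k = ≼-trans (Δ-mono-multiple q k)
      (subst (Δ (q * d + k) ≼Δ_) (sym (+-assoc d (q * d) k)) (Δ-mono (q * d + k)))

    growth-mono : ∀ q L a → f (L + a) ⊖ f a ≼ f (L + (q * d + a)) ⊖ f (q * d + a)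
    growth-mono q zero    a = ≤⇒≼ (≤-reflexive (+-comm (f a) (f (q * d + a))))
    growth-mono q (suc L) a = ≼-telescope
      (subst (Δ (L + a) ≼Δ_) (x∙yz≈y∙xz (q * d) L a) (Δ-mono-multiple q (L + a)))
      (growth-mono q L a)

data Mod4From6 : ℕ → Set where
  6+4t : ∀ t → Mod4From6 (6 + t * 4)
  7+4t : ∀ t → Mod4From6 (7 + t * 4)
  8+4t : ∀ t → Mod4From6 (8 + t * 4)
  9+4t : ∀ t → Mod4From6 (9 + t * 4)

mod4From6 : ∀ k → Mod4From6 (6 + k)
mod4From6 0 = 6+4t 0
mod4From6 1 = 7+4t 0
mod4From6 2 = 8+4t 0
mod4From6 3 = 9+4t 0
mod4From6 (suc (suc (suc (suc k)))) with mod4From6 k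
... | 6+4t t = 6+4t (suc t)
... | 7+4t t = 7+4t (suc t)
... | 8+4t t = 8+4t (suc t)
... | 9+4t t = 9+4t (suc t)

recurrence : ∀ {n} → Mod4From6 n → (ℕ → ℕ) → ℕ
recurrence (6+4t t) y = 5 + t * 4 + (y (3 + t * 2) + y (2 + t * 2))
recurrence (7+4t t) y = 6 + t * 4 + 2 * y (3 + t * 2)
recurrence (8+4t t) y = 7 + t * 4 + (y (4 + t * 2) + y (3 + t * 2))
recurrence (9+4t t) y = 8 + t * 4 + (y (5 + t * 2) + y (3 + t * 2))

c+t*2<d+t*4 : ∀ {c d} t → c < d → c + t * 2 < d + t * 4
c+t*2<d+t*4 t c<d = +-mono-<-≤ c<d (*-monoʳ-≤ t (≤ᵇ⇒≤ 2 4 _))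

recurrence-cong : ∀ {n} (v : Mod4From6 n) {y z : ℕ → ℕ} →
                  (∀ {i} → i < n ∸ 1 → y i ≡ z i) → recurrence v y ≡ recurrence v z
recurrence-cong (6+4t t) y≗z = cong₂ (λ a b → 5 + t * 4 + (a + b))
  (y≗z (c+t*2<d+t*4 t (<ᵇ⇒< 3 5 _))) (y≗z (c+t*2<d+t*4 t (<ᵇ⇒< 2 5 _)))
recurrence-cong (7+4t t) y≗z = cong (λ a → 6 + t * 4 + 2 * a)
  (y≗z (c+t*2<d+t*4 t (<ᵇ⇒< 3 6 _)))
recurrence-cong (8+4t t) y≗z = cong₂ (λ a b → 7 + t * 4 + (a + b))
  (y≗z (c+t*2<d+t*4 t (<ᵇ⇒< 4 7 _))) (y≗z (c+t*2<d+t*4 t (<ᵇ⇒< 3 7 _)))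
recurrence-cong (9+4t t) y≗z = cong₂ (λ a b → 8 + t * 4 + (a + b))
  (y≗z (c+t*2<d+t*4 t (<ᵇ⇒< 5 8 _))) (y≗z (c+t*2<d+t*4 t (<ᵇ⇒< 3 8 _)))

[c*2+t*4]/2≡c+t*2 : ∀ c t → (c * 2 + t * 4) / 2 ≡ c + t * 2
[c*2+t*4]/2≡c+t*2 c t = trans (cong (_/ 2) (c*2+t*4≡[c+t*2]*2 c t)) (m*n/n≡m (c + t * 2) 2)
  where
  c*2+t*4≡[c+t*2]*2 : ∀ c t → c * 2 + t * 4 ≡ (c + t * 2) * 2
  c*2+t*4≡[c+t*2]*2 = solve-∀

xAux-unfold : ∀ f {n} (v : Mod4From6 n) → xAux (suc f) n ≡ recurrence v (xAux f)
xAux-unfold f (6+4t t) with (6 + t * 4) % 4 | [m+kn]%n≡m%n 6 t 4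
... | _ | refl = cong₂ (λ a b → 5 + t * 4 + (xAux f a + xAux f b))
  ([c*2+t*4]/2≡c+t*2 3 t) ([c*2+t*4]/2≡c+t*2 2 t)
xAux-unfold f (7+4t t) with (7 + t * 4) % 4 | [m+kn]%n≡m%n 7 t 4
... | _ | refl = cong (λ a → 6 + t * 4 + 2 * xAux f a)
  ([c*2+t*4]/2≡c+t*2 3 t)
xAux-unfold f (8+4t t) with (8 + t * 4) % 4 | [m+kn]%n≡m%n 8 t 4
... | _ | refl = cong₂ (λ a b → 7 + t * 4 + (xAux f a + xAux f b))
  ([c*2+t*4]/2≡c+t*2 4 t) ([c*2+t*4]/2≡c+t*2 3 t)
xAux-unfold f (9+4t t) with (9 + t * 4) % 4 | [m+kn]%n≡m%n 9 t 4
... | _ | refl = cong₂ (λ a b → 8 + t * 4 + (xAux f a + xAux f b))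
  (trans (cong (_/ 2) (+-comm (9 + t * 4) 1)) ([c*2+t*4]/2≡c+t*2 5 t)) ([c*2+t*4]/2≡c+t*2 3 t)

xAux-0 : ∀ f → xAux f 0 ≡ 0
xAux-0 zero    = refl
xAux-0 (suc f) = refl

xAux-fuel-irrelevant : ∀ f g n → n ≤ f → n ≤ g → xAux f n ≡ xAux g n
xAux-fuel-irrelevant f       g       zero _ _ = trans (xAux-0 f) (sym (xAux-0 g))
xAux-fuel-irrelevant zero    _       (suc _) () _
xAux-fuel-irrelevant (suc _) zero    (suc _) _ ()
xAux-fuel-irrelevant (suc f) (suc g) 1 _ _ = refl
xAux-fuel-irrelevant (suc f) (suc g) 2 _ _ = refl
xAux-fuel-irrelevant (suc f) (suc g) 3 _ _ = refl
xAux-fuel-irrelevant (suc f) (suc g) 4 _ _ = refl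
xAux-fuel-irrelevant (suc f) (suc g) 5 _ _ = refl
xAux-fuel-irrelevant (suc f) (suc g) n@(suc (suc (suc (suc (suc (suc k)))))) (s≤s n-1≤f) (s≤s n-1≤g) =
  begin
    xAux (suc f) n          ≡⟨ xAux-unfold f v ⟩
    recurrence v (xAux f)   ≡⟨ recurrence-cong v agree ⟩
    recurrence v (xAux g)   ≡⟨ xAux-unfold g v ⟨
    xAux (suc g) n          ∎
  where
  open ≡-Reasoning
  v : Mod4From6 n
  v = mod4From6 k
  agree : ∀ {i} → i < n ∸ 1 → xAux f i ≡ xAux g i
  agree i<n-1 = xAux-fuel-irrelevant f g _
    (≤-trans (<⇒≤ i<n-1) n-1≤f) (≤-trans (<⇒≤ i<n-1) n-1≤g)

xAux≡x : ∀ {f n} → n ≤ f → xAux f n ≡ x n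
xAux≡x {f} {n} n≤f = xAux-fuel-irrelevant f n n n≤f ≤-refl

x-unfold : ∀ {n} (v : Mod4From6 n) → x n ≡ recurrence v x
x-unfold {n@(suc n-1)} v =
  trans (xAux-unfold n-1 v) (recurrence-cong v (λ i<n-1 → xAux≡x (<⇒≤ i<n-1)))

open Increments x

Δx-6+4t : ∀ t → Δ (6 + t * 4) ≡1+Δ (2 + t * 2)
Δx-6+4t t .≡1+Δ⇒≡ rewrite x-unfold (7+4t t) | x-unfold (6+4t t) =
  identity (t * 4) (x (3 + t * 2)) (x (2 + t * 2))
  where
  identity : ∀ T a c → 6 + T + 2 * a + c ≡ suc (a + (5 + T + (a + c)))
  identity = solve-∀

Δx-7+4t : ∀ t → Δ (7 + t * 4) ≡1+Δ (3 + t * 2)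
Δx-7+4t t .≡1+Δ⇒≡ rewrite x-unfold (8+4t t) | x-unfold (7+4t t) =
  identity (t * 4) (x (4 + t * 2)) (x (3 + t * 2))
  where
  identity : ∀ T b a → 7 + T + (b + a) + a ≡ suc (b + (6 + T + 2 * a))
  identity = solve-∀

Δx-8+4t : ∀ t → Δ (8 + t * 4) ≡1+Δ (4 + t * 2)
Δx-8+4t t .≡1+Δ⇒≡ rewrite x-unfold (9+4t t) | x-unfold (8+4t t) =
  identity (t * 4) (x (5 + t * 2)) (x (4 + t * 2)) (x (3 + t * 2))
  where
  identity : ∀ T d b a → 8 + T + (d + a) + b ≡ suc (d + (7 + T + (b + a)))
  identity = solve-∀

Δx-9+4t : ∀ t → Δ (9 + t * 4) ≡1+Δ (3 + t * 2)
Δx-9+4t t .≡1+Δ⇒≡ rewrite x-unfold (6+4t (suc t)) | x-unfold (9+4t t) =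
  identity (t * 4) (x (5 + t * 2)) (x (4 + t * 2)) (x (3 + t * 2))
  where
  identity : ∀ T d b a → 9 + T + (d + b) + a ≡ suc (b + (8 + T + (d + a)))
  identity = solve-∀

Δx-mono₂ : ∀ k → Δ k ≼Δ (2 + k)
Δx-mono₂ = <-rec _ step
  where
  step : ∀ k → (∀ {i} → i < k → Δ i ≼Δ (2 + i)) → Δ k ≼Δ (2 + k)
  step 0 _ = ≤⇒≼ (≤ᵇ⇒≤ _ _ _)
  step 1 _ = ≤⇒≼ (≤ᵇ⇒≤ _ _ _)
  step 2 _ = ≤⇒≼ (≤ᵇ⇒≤ _ _ _)
  step 3 _ = ≤⇒≼ (≤ᵇ⇒≤ _ _ _)
  step 4 _ = ≤⇒≼ (≤ᵇ⇒≤ _ _ _)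
  step 5 _ = ≤⇒≼ (≤ᵇ⇒≤ _ _ _)
  step (suc (suc (suc (suc (suc (suc k)))))) ih with mod4From6 k
  ... | 6+4t t = ≡1+Δ⇒≼Δ (Δx-6+4t t) (Δx-8+4t t) (ih (c+t*2<d+t*4 t (<ᵇ⇒< 2 6 _)))
  ... | 7+4t t = ≡1+Δ⇒≼Δ (Δx-7+4t t) (Δx-9+4t t) ≼-refl
  ... | 8+4t t = ≡1+Δ⇒≼Δ (Δx-8+4t t) (Δx-6+4t (suc t)) ≼-refl
  ... | 9+4t t = ≡1+Δ⇒≼Δ (Δx-9+4t t) (Δx-7+4t (suc t)) (ih (c+t*2<d+t*4 t (<ᵇ⇒< 3 9 _)))

x-growth-mono-at : ∀ q L a {e} → e ≡ L + (q * 2 + a) → x (L + a) ⊖ x a ≼ x e ⊖ x (q * 2 + a)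
x-growth-mono-at q L a refl = growth-mono 2 Δx-mono₂ q L a

n≡1+j+[n∸j∸1] : ∀ {n j} → j + 2 ≤ n → n ≡ suc (j + (n ∸ j ∸ 1))
n≡1+j+[n∸j∸1] {j = zero}  (s≤s (s≤s _)) = refl
n≡1+j+[n∸j∸1] {j = suc j} (s≤s j+2≤n)   = cong suc (n≡1+j+[n∸j∸1] j+2≤n)

corollary2 : (n j : ℕ) → j + 2 ≤ n →
    (j % 2 ≡ 1 → x (n ∸ 2) + x n ≤ x (n + j ∸ 1) + x (n ∸ j ∸ 1))
    × (j % 2 ≡ 0 → 2 * x (n ∸ 1) ≤ x (n + j ∸ 1) + x (n ∸ j ∸ 1))
corollary2 n j j+2≤n with n ∸ j ∸ 1 | n≡1+j+[n∸j∸1] j+2≤n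
... | a | refl with j % 2 | j / 2 | m≡m%n+[m/n]*n j 2
... | _ | q | refl =
  (λ { refl → ≼⇒≤ (x-growth-mono-at (suc q) (q * 2) a (odd-endpoint q a)) }) ,
  (λ { refl → ≤-trans (≤-reflexive (twice (x (q * 2 + a))))
                (≼⇒≤ (x-growth-mono-at q (q * 2) a (+-comm (q * 2 + a) (q * 2)))) })
  where
  odd-endpoint : ∀ q a → suc (q * 2 + a + suc (q * 2)) ≡ q * 2 + (suc q * 2 + a)
  odd-endpoint = solve-∀
  twice : ∀ m → 2 * m ≡ m + m
  twice m = cong (m +_) (+-identityʳ m)
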